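{- Let X be any of the variants E, S, G of the halting problem. For every three-way tester $T$ for X there is a generic-case tester for X that has precisely the same easy ``yes''-instances, the same easy ``no''-instances, the same hard halting instances and the same hard non-halting instances as $T$. Moreover, there is an approximating tester for X that has precisely the same easy ``yes''-instances as $T$, at least the easy ``no''-instances of $T$, precisely the same hard halting instances as $T$, and no hard non-halting instances; and there is an approximating tester for X that has at least the easy ``yes''-instances of $T$, precisely the same easy ``no''-instances as $T$, no hard halting instances, and precisely the same hard non-halting instances as $T$.
   Context: A programming language consists of a finite alphabet $\Sigma$ with $|\Sigma|\ge 2$ and a set of programs (strings over $\Sigma$); every program, on every input string over $\Sigma$, either halts or runs forever, and programs can be effectively constructed and simulated by other programs. Variants of the halting problem: E — instances are programs, the question is whether the program halts on the empty input; S — instances are programs, the question is whether the program halts when given itself as input; G — instances are program–input pairs, the question is whether the program halts on the input. A tester for a variant is a program taking an instance as input. A three-way tester always halts and answers ``yes'', ``no'' or ``I don't know'', where ``yes'' may only be given on halting instances and ``no'' only on non-halting instances. A generic-case tester, on each instance, either halts with a correct answer ``yes'' or ``no'', or fails to halt. An approximating tester always halts with answer ``yes'' or ``no'', which may be incorrect. An instance is easy for a tester if the tester correctly answers ``yes'' or ``no'' on it, and hard otherwise. An easy ``yes''-instance is an instance on which the tester correctly answers ``yes'' (similarly for ``no''). -}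

module Defs where

open import Level using (0ℓ)
open import Data.Nat using (ℕ; suc; _≤_)
open import Data.Fin using (Fin)
open import Data.List using (List; [])
open import Data.Maybe using (Maybe; just)
open import Data.Product using (Σ; ∃; ∃-syntax; _×_; _,_; proj₁)
open import Data.Sum using (_⊎_)
open import Relation.Nullary using (¬_)
open import Relation.Binary.PropositionalEquality using (_≡_; _≢_)

record ProgrammingLanguage : Set₁ where
  field
    k       : ℕ
    2≤k     : 2 ≤ k
  Str : Set
  Str = List (Fin k)
  field
    IsProg  : Str → Set
    -- step-indexed execution: run p x n = just o  iff  p on input x has
    -- halted within n steps with output o; nothing = not yet halted
    run     : Str → Str → ℕ → Maybe Str
    run-mono : ∀ p x n o → run p x n ≡ just o → run p x (suc n) ≡ just o
    pair    : Str → Str → Str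
    pair-injective : ∀ p x q y → pair p x ≡ pair q y → (p ≡ q) × (x ≡ y)
    yes no idk : Str
    yes≢no  : yes ≢ no
    yes≢idk : yes ≢ idk
    no≢idk  : no ≢ idk
    -- effective construction / simulation: from a program p one can build
    -- a program q that simulates p and, when p halts with output s,
    -- instead outputs o' if r = just o' and runs forever if r = nothing;
    -- all other behaviour of p is kept unchanged.
    replace : ∀ p → IsProg p → (s : Str) (r : Maybe Str) →
      Σ Str λ q → IsProg q × (∀ x o' →
        ((∃[ n ] run q x n ≡ just o') →
           ∃[ o ] (∃[ n ] run p x n ≡ just o) ×
             ((o ≢ s × o' ≡ o) ⊎ (o ≡ s × r ≡ just o')))
        × ((∃[ o ] (∃[ n ] run p x n ≡ just o) ×
             ((o ≢ s × o' ≡ o) ⊎ (o ≡ s × r ≡ just o')))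
           → ∃[ n ] run q x n ≡ just o'))

module _ (L : ProgrammingLanguage) where
  open ProgrammingLanguage L

  _∙_⇓_ : Str → Str → Str → Set
  p ∙ x ⇓ o = ∃[ n ] run p x n ≡ just o

  Halts : Str → Str → Set
  Halts p x = ∃[ o ] p ∙ x ⇓ o

  Program : Set
  Program = Σ Str IsProg

  data Variant : Set where
    E S G : Variant

  Instance : Variant → Set
  Instance E = Program
  Instance S = Program
  Instance G = Σ (Str × Str) λ px → IsProg (proj₁ px)

  code : (X : Variant) → Instance X → Str
  code E (p , _) = p
  code S (p , _) = p
  code G ((p , x) , _) = pair p x

  HaltingInstance : (X : Variant) → Instance X → Set
  HaltingInstance E (p , _) = Halts p []
  HaltingInstance S (p , _) = Halts p p
  HaltingInstance G ((p , x) , _) = Halts p x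

  Answers : (X : Variant) → Str → Instance X → Str → Set
  Answers X t i o = t ∙ code X i ⇓ o

  ThreeWayTester : (X : Variant) → Str → Set
  ThreeWayTester X t = IsProg t × (∀ i →
      (∃[ o ] Answers X t i o × (o ≡ yes ⊎ o ≡ no ⊎ o ≡ idk))
    × (Answers X t i yes → HaltingInstance X i)
    × (Answers X t i no → ¬ HaltingInstance X i))

  GenericCaseTester : (X : Variant) → Str → Set
  GenericCaseTester X t = IsProg t × (∀ i o → Answers X t i o →
      (o ≡ yes × HaltingInstance X i) ⊎ (o ≡ no × ¬ HaltingInstance X i))

  ApproximatingTester : (X : Variant) → Str → Set
  ApproximatingTester X t = IsProg t × (∀ i →
      ∃[ o ] Answers X t i o × (o ≡ yes ⊎ o ≡ no))

  EasyYes : (X : Variant) → Str → Instance X → Set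
  EasyYes X t i = Answers X t i yes × HaltingInstance X i

  EasyNo : (X : Variant) → Str → Instance X → Set
  EasyNo X t i = Answers X t i no × ¬ HaltingInstance X i

  Easy : (X : Variant) → Str → Instance X → Set
  Easy X t i = EasyYes X t i ⊎ EasyNo X t i

  HardHalting : (X : Variant) → Str → Instance X → Set
  HardHalting X t i = HaltingInstance X i × ¬ Easy X t i

  HardNonHalting : (X : Variant) → Str → Instance X → Set
  HardNonHalting X t i = ¬ HaltingInstance X i × ¬ Easy X t i

  _⇔_ : Set → Set → Set
  A ⇔ B = (A → B) × (B → A)

module Submission where

-- Relabel the answer "I don't know" of the three-way tester t: dropping it
-- (running forever instead) gives a generic-case tester, and replacing it by
-- "no" or by "yes" gives the two approximating testers. Only idk-instances
-- change, and these are hard for t. Whether an instance is hard and halting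
-- depends only on the easy "yes"-instances, and dually, so the hard sets
-- are controlled by the easy ones.

open import Defs
open import Data.Maybe using (Maybe; just; nothing)
open import Data.Maybe.Properties using (just-injective)
open import Data.Nat using (zero; suc; _+_)
open import Data.Nat.Properties using (+-comm)
open import Data.Product using (Σ; _×_; _,_; proj₁; proj₂; map₁)
open import Data.Sum using (_⊎_; inj₁; inj₂)
open import Function using (_∘_)
open import Relation.Nullary using (¬_; contradiction)
open import Relation.Binary.PropositionalEquality
  using (_≡_; _≢_; refl; sym; cong; module ≡-Reasoning)
open ProgrammingLanguage using (Str)

module Execution (L : ProgrammingLanguage) where
  open ProgrammingLanguage L hiding (Str)

  run-mono-+ : ∀ {p x n o} k → run p x n ≡ just o → run p x (k + n) ≡ just o
  run-mono-+ zero e = e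
  run-mono-+ {p} {x} {n} {o} (suc k) e = run-mono p x (k + n) o (run-mono-+ k e)

  ⇓-functional : ∀ {p x o o′} → _∙_⇓_ L p x o → _∙_⇓_ L p x o′ → o ≡ o′
  ⇓-functional {p} {x} {o} {o′} (n , e) (m , e′) = just-injective (begin
    just o           ≡⟨ sym (run-mono-+ m e) ⟩
    run p x (m + n)  ≡⟨ cong (run p x) (+-comm m n) ⟩
    run p x (n + m)  ≡⟨ run-mono-+ n e′ ⟩
    just o′          ∎)
    where open ≡-Reasoning

  module Replace (p : Str L) (p-prog : IsProg p) (s : Str L) (r : Maybe (Str L)) where

    q : Str L
    q = proj₁ (replace p p-prog s r)

    q-prog : IsProg q
    q-prog = proj₁ (proj₂ (replace p p-prog s r))

    ⇓-origin : ∀ {x o′} → _∙_⇓_ L q x o′ →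
      (_∙_⇓_ L p x o′ × o′ ≢ s) ⊎ (_∙_⇓_ L p x s × r ≡ just o′)
    ⇓-origin {x} {o′} h with proj₁ (proj₂ (proj₂ (replace p p-prog s r)) x o′) h
    ... | _ , hp , inj₁ (o≢s , refl) = inj₁ (hp , o≢s)
    ... | _ , hp , inj₂ (refl , e)   = inj₂ (hp , e)

    ⇓-kept : ∀ {x o} → _∙_⇓_ L p x o → o ≢ s → _∙_⇓_ L q x o
    ⇓-kept {x} {o} hp o≢s =
      proj₂ (proj₂ (proj₂ (replace p p-prog s r)) x o) (o , hp , inj₁ (o≢s , refl))

    ⇓-replaced : ∀ {x o′} → _∙_⇓_ L p x s → r ≡ just o′ → _∙_⇓_ L q x o′
    ⇓-replaced {x} {o′} hp e =
      proj₂ (proj₂ (proj₂ (replace p p-prog s r)) x o′) (s , hp , inj₂ (refl , e))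

    ⇓-preserved : ∀ {x o} → o ≢ s → r ≢ just o → _⇔_ L (_∙_⇓_ L q x o) (_∙_⇓_ L p x o)
    ⇓-preserved {x} {o} o≢s r≢o = from , λ hp → ⇓-kept hp o≢s
      where
      from : _∙_⇓_ L q x o → _∙_⇓_ L p x o
      from h with ⇓-origin h
      ... | inj₁ (hp , _) = hp
      ... | inj₂ (_ , e)  = contradiction e r≢o

module Testers (L : ProgrammingLanguage) (X : Variant L) where
  open ProgrammingLanguage L hiding (Str)
  open Execution L

  threeWay-definite : ∀ {t i o} → ThreeWayTester L X t → Answers L X t i o → o ≢ idk →
    (o ≡ yes × HaltingInstance L X i) ⊎ (o ≡ no × ¬ HaltingInstance L X i)
  threeWay-definite {i = i} (_ , spec) h o≢idk with spec i
  ... | (_ , h′ , answer) , sound-yes , sound-no with ⇓-functional h h′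
  ... | refl with answer
  ... | inj₁ refl        = inj₁ (refl , sound-yes h)
  ... | inj₂ (inj₁ refl) = inj₂ (refl , sound-no h)
  ... | inj₂ (inj₂ refl) = contradiction refl o≢idk

  -- A halting instance can only be easy by a correct "yes", and dually.
  hardHalting-cong : ∀ {a b i} → _⇔_ L (EasyYes L X a i) (EasyYes L X b i) →
    _⇔_ L (HardHalting L X a i) (HardHalting L X b i)
  hardHalting-cong {i = i} (to , from) = transfer from , transfer to
    where
    transfer : ∀ {c d} → (EasyYes L X d i → EasyYes L X c i) →
      HardHalting L X c i → HardHalting L X d i
    transfer f (halts , ¬easy) = halts , λ
      { (inj₁ easy-yes)     → ¬easy (inj₁ (f easy-yes))
      ; (inj₂ (_ , ¬halts)) → ¬halts halts }

  hardNonHalting-cong : ∀ {a b i} → _⇔_ L (EasyNo L X a i) (EasyNo L X b i) →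
    _⇔_ L (HardNonHalting L X a i) (HardNonHalting L X b i)
  hardNonHalting-cong {i = i} (to , from) = transfer from , transfer to
    where
    transfer : ∀ {c d} → (EasyNo L X d i → EasyNo L X c i) →
      HardNonHalting L X c i → HardNonHalting L X d i
    transfer f (¬halts , ¬easy) = ¬halts , λ
      { (inj₁ (_ , halts)) → ¬halts halts
      ; (inj₂ easy-no)     → ¬easy (inj₂ (f easy-no)) }

  approximating-yes-sound⇒¬HardNonHalting : ∀ {a i} → ApproximatingTester L X a →
    (Answers L X a i yes → HaltingInstance L X i) → ¬ HardNonHalting L X a i
  approximating-yes-sound⇒¬HardNonHalting {i = i} (_ , total) sound (¬halts , ¬easy)
    with total i
  ... | _ , h , inj₁ refl = ¬halts (sound h)
  ... | _ , h , inj₂ refl = ¬easy (inj₂ (h , ¬halts))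

  approximating-no-sound⇒¬HardHalting : ∀ {a i} → ApproximatingTester L X a →
    (Answers L X a i no → ¬ HaltingInstance L X i) → ¬ HardHalting L X a i
  approximating-no-sound⇒¬HardHalting {i = i} (_ , total) sound (halts , ¬easy)
    with total i
  ... | _ , h , inj₁ refl = ¬easy (inj₁ (h , halts))
  ... | _ , h , inj₂ refl = sound h halts

  -- t with its answer idk relabelled by r; r = nothing makes it diverge there.
  module Relabel {t : Str L} (T : ThreeWayTester L X t) (r : Maybe (Str L)) where
    open Replace t (proj₁ T) idk r public

    answers-preserved : ∀ {i o} → o ≢ idk → r ≢ just o →
      _⇔_ L (Answers L X q i o) (Answers L X t i o)
    answers-preserved = ⇓-preserved

    easyYes-preserved : ∀ {i} → r ≢ just yes → _⇔_ L (EasyYes L X q i) (EasyYes L X t i)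
    easyYes-preserved r≢yes =
      let to , from = answers-preserved yes≢idk r≢yes in map₁ to , map₁ from

    easyNo-preserved : ∀ {i} → r ≢ just no → _⇔_ L (EasyNo L X q i) (EasyNo L X t i)
    easyNo-preserved r≢no =
      let to , from = answers-preserved no≢idk r≢no in map₁ to , map₁ from

    dropping-idk-is-generic : r ≡ nothing → GenericCaseTester L X q
    dropping-idk-is-generic refl = q-prog , λ _ _ → definite
      where
      definite : ∀ {i o} → Answers L X q i o →
        (o ≡ yes × HaltingInstance L X i) ⊎ (o ≡ no × ¬ HaltingInstance L X i)
      definite h with ⇓-origin h
      ... | inj₁ (ht , o≢idk) = threeWay-definite T ht o≢idk
      ... | inj₂ (_ , ())

    replacing-idk-is-approximating : ∀ {c} → r ≡ just c → c ≡ yes ⊎ c ≡ no →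
      ApproximatingTester L X q
    replacing-idk-is-approximating {c} r≡c c-definite = q-prog , total
      where
      total : ∀ i → Σ (Str L) λ o → Answers L X q i o × (o ≡ yes ⊎ o ≡ no)
      total i with proj₂ T i
      ... | (_ , h , inj₁ refl) , _        = yes , ⇓-kept h yes≢idk , inj₁ refl
      ... | (_ , h , inj₂ (inj₁ refl)) , _ = no , ⇓-kept h no≢idk , inj₂ refl
      ... | (_ , h , inj₂ (inj₂ refl)) , _ = c , ⇓-replaced h r≡c , c-definite

proposition1 : (L : ProgrammingLanguage) (X : Variant L) (t : Str L) →
    ThreeWayTester L X t →
    (Σ (Str L) λ g → GenericCaseTester L X g
      × (∀ i → _⇔_ L (EasyYes L X g i) (EasyYes L X t i))
      × (∀ i → _⇔_ L (EasyNo L X g i) (EasyNo L X t i))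
      × (∀ i → _⇔_ L (HardHalting L X g i) (HardHalting L X t i))
      × (∀ i → _⇔_ L (HardNonHalting L X g i) (HardNonHalting L X t i)))
    × (Σ (Str L) λ a → ApproximatingTester L X a
      × (∀ i → _⇔_ L (EasyYes L X a i) (EasyYes L X t i))
      × (∀ i → EasyNo L X t i → EasyNo L X a i)
      × (∀ i → _⇔_ L (HardHalting L X a i) (HardHalting L X t i))
      × (∀ i → ¬ HardNonHalting L X a i))
    × (Σ (Str L) λ a → ApproximatingTester L X a
      × (∀ i → EasyYes L X t i → EasyYes L X a i)
      × (∀ i → _⇔_ L (EasyNo L X a i) (EasyNo L X t i))
      × (∀ i → ¬ HardHalting L X a i)
      × (∀ i → _⇔_ L (HardNonHalting L X a i) (HardNonHalting L X t i)))
proposition1 L X t T@(_ , spec) =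
    (G.q , G.dropping-idk-is-generic refl
         , (λ _ → G.easyYes-preserved λ ()) , (λ _ → G.easyNo-preserved λ ())
         , (λ _ → hardHalting-cong (G.easyYes-preserved λ ()))
         , (λ _ → hardNonHalting-cong (G.easyNo-preserved λ ())))
  , (N.q , N-approx
         , (λ _ → N.easyYes-preserved just-no≢yes)
         , (λ _ → map₁ λ h → N.⇓-kept h no≢idk)
         , (λ _ → hardHalting-cong (N.easyYes-preserved just-no≢yes))
         , (λ i → approximating-yes-sound⇒¬HardNonHalting N-approx
                    (proj₁ (proj₂ (spec i)) ∘ proj₁ (N.answers-preserved yes≢idk just-no≢yes))))
  , (Y.q , Y-approx
         , (λ _ → map₁ λ h → Y.⇓-kept h yes≢idk)
         , (λ _ → Y.easyNo-preserved just-yes≢no)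
         , (λ i → approximating-no-sound⇒¬HardHalting Y-approx
                    (proj₂ (proj₂ (spec i)) ∘ proj₁ (Y.answers-preserved no≢idk just-yes≢no)))
         , (λ _ → hardNonHalting-cong (Y.easyNo-preserved just-yes≢no)))
  where
  open ProgrammingLanguage L using (yes; no; yes≢no; yes≢idk; no≢idk)
  open Testers L X
  module G = Relabel T nothing
  module N = Relabel T (just no)
  module Y = Relabel T (just yes)

  just-no≢yes : just no ≢ just yes
  just-no≢yes e = yes≢no (sym (just-injective e))

  just-yes≢no : just yes ≢ just no
  just-yes≢no e = yes≢no (just-injective e)

  N-approx : ApproximatingTester L X N.q
  N-approx = N.replacing-idk-is-approximating refl (inj₂ refl)

  Y-approx : ApproximatingTester L X Y.q
  Y-approx = Y.replacing-idk-is-approximating refl (inj₁ refl)
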